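{- Let $G$ be an equatorial graph with equator $q$, girth $g$ and minimum degree $\delta$, and let $k=\lceil g/2\rceil-1$. Let $C=u_0,u_1,\dots,u_{q-1}$ be an isometric cycle of $G$ of length $q$, and let $e_i=u_iu_{i+1}$ (indices mod $q$). (1) If $g$ is odd, then $|\mathcal{D}_k(u_i)|=M(\delta,g)$ for every $i$; moreover every vertex $v$ of $G$ lies in exactly $g$ of the sets $\mathcal{D}_k(u_i)$, and the set of indices $i$ with $v\in\mathcal{D}_k(u_i)$ is of the form $\{j-k,j-k+1,\dots,j+k\}$ (mod $q$) for some $j$. (2) If $g$ is even, then $|\mathcal{D}_k(e_i)|=M(\delta,g)$ for every $i$; moreover every vertex $v$ of $G$ lies in exactly $g$ of the sets $\mathcal{D}_k(e_i)$, and the set of indices $i$ with $v\in\mathcal{D}_k(e_i)$ is of the form $\{j-k-1,j-k,\dots,j+k\}$ (mod $q$) for some $j$.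
   Context: For a vertex $u$, $\mathcal{D}_i(u)=\{v: d(u,v)\le i\}$; for an edge $e=uv$, $\mathcal{D}_i(e)=\mathcal{D}_i(u)\cup\mathcal{D}_i(v)$. A cycle $C$ is isometric if $d_C(x,y)=d_G(x,y)$ for all $x,y\in V(C)$; the equator is the length of a longest isometric cycle. For $\delta\ge2$, $g\ge3$, $k=\lceil g/2\rceil-1$, the Moore bound is $M(\delta,g)=1+\sum_{i=0}^{k-1}\delta(\delta-1)^i$ for odd $g$ and $M(\delta,g)=2+\sum_{i=1}^{k}2(\delta-1)^i$ for even $g$. An equatorial graph is a finite graph with girth $g$, minimum degree $\delta$ and equator $q>6k+3$ (where $k=\lceil g/2\rceil-1$) whose order is exactly $\frac{q}{g}M(\delta,g)$. -}

module Defs where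

open import Data.Nat using (ℕ; zero; suc; _+_; _*_; _∸_; _^_; _≤_; _<_; _%_; ⌈_/2⌉; ∣_-_∣; _⊓_)
open import Data.Nat.DivMod using (m%n<n)
open import Data.Fin using (Fin; toℕ; fromℕ<)
open import Data.List using (List; length)
open import Data.List.Membership.Propositional using (_∈_)
open import Data.List.Relation.Unary.Unique.Propositional using (Unique)
open import Data.Product using (Σ; ∃; _×_; _,_)
open import Data.Sum using (_⊎_)
open import Function.Bundles using (_⇔_)
open import Function.Definitions using (Injective)
open import Relation.Binary.PropositionalEquality using (_≡_)
open import Relation.Nullary using (¬_; Dec)

record Graph : Set₁ where
  field
    n     : ℕ
    Adj   : Fin n → Fin n → Set
    adj?  : ∀ u v → Dec (Adj u v)
    sym   : ∀ {u v} → Adj u v → Adj v u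
    irrefl : ∀ {u} → ¬ Adj u u

open Graph public

HasCard : {A : Set} → (A → Set) → ℕ → Set
HasCard {A} P c = Σ (List A) λ ℓ → Unique ℓ × (∀ x → (x ∈ ℓ) ⇔ P x) × length ℓ ≡ c

module _ (G : Graph) where

  data Walk : Fin (n G) → Fin (n G) → ℕ → Set where
    nil  : ∀ u → Walk u u 0
    cons : ∀ {u w v l} → Adj G u w → Walk w v l → Walk u v (suc l)

  Dist : Fin (n G) → Fin (n G) → ℕ → Set
  Dist u v d = Walk u v d × (∀ l → Walk u v l → d ≤ l)

  InBall : ℕ → Fin (n G) → Fin (n G) → Set
  InBall i u v = Σ ℕ λ d → Dist u v d × d ≤ i

  InEdgeBall : ℕ → Fin (n G) → Fin (n G) → Fin (n G) → Set
  InEdgeBall i u w v = InBall i u v ⊎ InBall i w v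

next : ∀ {m} → Fin m → Fin m
next {suc m} i = fromℕ< (m%n<n (suc (toℕ i)) (suc m))

cycDist : (m : ℕ) → ℕ → ℕ → ℕ
cycDist m i j = ∣ i - j ∣ ⊓ (m ∸ ∣ i - j ∣)

module _ (G : Graph) where

  IsCycle : (m : ℕ) → (Fin m → Fin (n G)) → Set
  IsCycle m c = 3 ≤ m × Injective _≡_ _≡_ c × (∀ i → Adj G (c i) (c (next i)))

  IsIsometricCycle : (m : ℕ) → (Fin m → Fin (n G)) → Set
  IsIsometricCycle m c =
    IsCycle m c × (∀ i j → Dist G (c i) (c j) (cycDist m (toℕ i) (toℕ j)))

  Girth : ℕ → Set
  Girth g = (Σ (Fin g → Fin (n G)) λ c → IsCycle g c)
          × (∀ m c → IsCycle m c → g ≤ m)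

  Equator : ℕ → Set
  Equator q = (Σ (Fin q → Fin (n G)) λ c → IsIsometricCycle q c)
            × (∀ m c → IsIsometricCycle m c → m ≤ q)

  MinDegree : ℕ → Set
  MinDegree δ = (∀ v → Σ ℕ λ d → HasCard (Adj G v) d × δ ≤ d)
              × (Σ (Fin (n G)) λ v → HasCard (Adj G v) δ)

kOf : ℕ → ℕ
kOf g = ⌈ g /2⌉ ∸ 1

sumOdd : ℕ → ℕ → ℕ
sumOdd δ zero = 0
sumOdd δ (suc k) = sumOdd δ k + δ * (δ ∸ 1) ^ k

sumEven : ℕ → ℕ → ℕ
sumEven δ zero = 0
sumEven δ (suc k) = sumEven δ k + 2 * (δ ∸ 1) ^ suc k

Moore : ℕ → ℕ → ℕ
Moore δ g with g % 2
... | 0 = 2 + sumEven δ (kOf g)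
... | _ = 1 + sumOdd δ (kOf g)

IsEquatorial : Graph → ℕ → ℕ → ℕ → Set
IsEquatorial G g δ q =
  Girth G g × MinDegree G δ × Equator G q × 2 ≤ δ × 3 ≤ g
  × 6 * kOf g + 3 < q
  × n G * g ≡ q * Moore δ g   -- |V(G)| = (q/g) M(δ,g)

-- index i lies in {j-a, j-a+1, ..., j+b} (mod q)
InArc : (q : ℕ) → ℕ → ℕ → Fin q → Fin q → Set
InArc (suc q) a b j i = Σ ℕ λ t → t ≤ a + b × (toℕ i + a) % suc q ≡ (toℕ j + t) % suc q

{-# OPTIONS --safe #-}
-- For a vertex v, let J(v) be the set of positions i with v ∈ D_k(u_i) (v ∈ D_k(e_i) when g
-- is even).  Two positions of J(v) are joined through v by a walk of length at most 2k, so,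
-- C being isometric, they are at cyclic distance at most 2k; since q > 6k, J(v) then lies in
-- an arc of 2k + 1 positions (2k + 2 for edges), i.e. |J(v)| ≤ g.  On the other hand every
-- ball has at least M(δ, g) vertices: the non-backtracking walks of length at most k from the
-- centre have distinct ends, since two with a common end would close a cycle shorter than g,
-- and there are at least M(δ, g) of them.  Counting the pairs (i, v) both ways,
--   q M(δ, g) ≤ Σᵢ |D_k(u_i)| = Σ_v |J(v)| ≤ n g = q M(δ, g),
-- so every ball has exactly M(δ, g) vertices and every J(v) is a whole arc of g positions.

module Submission where

open import Defs hiding (sym)
open import Data.Bool.Base using (true; false)
open import Data.Empty using (⊥; ⊥-elim)
open import Data.Fin.Base using (Fin; zero; suc; toℕ; fromℕ<)
open import Data.Fin.Properties using (any?; toℕ<n; toℕ-fromℕ<; toℕ-injective) renaming (_≟_ to _≟ᶠ_)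
open import Data.List.Base using (List; []; _∷_; _++_; _ʳ++_; length; map; filter; tabulate; allFin; concatMap; lookup; upTo)
open import Data.List.Membership.Propositional using (_∈_; _∉_)
open import Data.List.Membership.Propositional.Properties using (∈-∃++; ∈-++⁻; ∈-++⁺ˡ; ∈-++⁺ʳ; ∈-filter⁺; ∈-filter⁻; ∈-allFin; ∈-lookup; ∈-map⁺; ∈-map⁻; ∈-concat⁻′; ∈-upTo⁺)
open import Data.List.Properties using (length-++; length-map; length-upTo; length-ʳ++; ++-assoc; ++-cancelʳ; ∷ʳ-injectiveʳ; filter-all)
open import Data.List.Relation.Binary.Disjoint.Propositional using (Disjoint)
open import Data.List.Relation.Binary.Subset.Propositional using (_⊆_)
open import Data.List.Relation.Unary.All as All using (All; []; _∷_)
import Data.List.Relation.Unary.All.Properties as All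
import Data.List.Relation.Unary.AllPairs as AllPairs
import Data.List.Relation.Unary.AllPairs.Properties as AllPairs
open import Data.List.Relation.Unary.Any using (here; there)
open import Data.List.Relation.Unary.Unique.Propositional using (Unique; []; _∷_)
open import Data.List.Relation.Unary.Unique.Propositional.Properties using (allFin⁺; filter⁺; concat⁺; ++⁺)
open import Data.Nat.Base using (ℕ; zero; suc; _+_; _*_; _∸_; _^_; _≤_; _<_; _%_; _/_; _⊓_; ∣_-_∣; ⌊_/2⌋; z≤n; s≤s; s≤s⁻¹)
open import Data.Nat.DivMod using (_mod_; m%n<n; m%n≤n; m%n%n≡m%n; %-distribˡ-+; [m+n]%n≡m%n; n%n≡0; m<n⇒m%n≡m; m≤n⇒[n∸m]%m≡n%m; m≡m%n+[m/n]*n)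
open import Data.Nat.Properties
open import Algebra.Properties.CommutativeMonoid.Sum +-0-commutativeMonoid using (sum; ∑-comm)
open import Data.Nat.Solver using (module +-*-Solver)
open import Data.Product using (Σ; ∃-syntax; _×_; _,_; proj₁; proj₂)
open import Data.Sum using (_⊎_; inj₁; inj₂)
open import Data.Unit using (⊤; tt)
open import Function.Bundles using (_⇔_; mk⇔; Equivalence)
open import Function.Properties.Equivalence using () renaming (trans to ⇔-trans)
open import Level using (0ℓ)
open import Relation.Binary.PropositionalEquality
open import Relation.Nullary using (Dec; yes; no; does; ¬_; ¬?)
open import Relation.Nullary.Decidable using (_×-dec_; _⊎-dec_; map′)
open import Relation.Unary using (Pred; Decidable)

-- Finite sets and counting

module _ {A : Set} where

  ∈-split : ∀ {y : A} {ys} → y ∈ ys →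
            ∃[ zs ] length ys ≡ suc (length zs) × (∀ {z} → z ∈ ys → z ≢ y → z ∈ zs)
  ∈-split {y} y∈ with ∈-∃++ y∈
  ... | xs , zs , refl = xs ++ zs , length-split xs , keep
    where
    length-split : ∀ xs → length (xs ++ y ∷ zs) ≡ suc (length (xs ++ zs))
    length-split []       = refl
    length-split (_ ∷ xs) = cong suc (length-split xs)
    keep : ∀ {z} → z ∈ xs ++ y ∷ zs → z ≢ y → z ∈ xs ++ zs
    keep z∈ z≢y with ∈-++⁻ xs z∈
    ... | inj₁ z∈xs         = ∈-++⁺ˡ z∈xs
    ... | inj₂ (here z≡y)   = ⊥-elim (z≢y z≡y)
    ... | inj₂ (there z∈zs) = ∈-++⁺ʳ xs z∈zs

  Unique-⊆⇒length≤ : ∀ {xs ys : List A} → Unique xs → xs ⊆ ys → length xs ≤ length ys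
  Unique-⊆⇒length≤ {[]}     _            _  = z≤n
  Unique-⊆⇒length≤ {x ∷ xs} (x∉xs ∷ !xs) xs⊆ys with ∈-split (xs⊆ys (here refl))
  ... | zs , |ys| , keep = ≤-trans (s≤s (Unique-⊆⇒length≤ !xs xs⊆zs)) (≤-reflexive (sym |ys|))
    where
    xs⊆zs : xs ⊆ zs
    xs⊆zs z∈xs = keep (xs⊆ys (there z∈xs)) λ z≡x → All.lookup x∉xs z∈xs (sym z≡x)

  ∉-Unique⇒Unique-∷ : ∀ {x : A} {xs} → x ∉ xs → Unique xs → Unique (x ∷ xs)
  ∉-Unique⇒Unique-∷ {xs = xs} x∉xs !xs = All.tabulate (λ y∈xs x≡y → x∉xs (subst (_∈ xs) (sym x≡y) y∈xs)) ∷ !xs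

  Unique-++⁻ˡ : ∀ (xs : List A) {ys} → Unique (xs ++ ys) → Unique xs
  Unique-++⁻ˡ []       _            = []
  Unique-++⁻ˡ (x ∷ xs) (x∉ ∷ !xsys) = All.++⁻ˡ xs x∉ ∷ Unique-++⁻ˡ xs !xsys

  Unique-++-∷⇒∉ : ∀ (xs : List A) {x ys} → Unique (xs ++ x ∷ ys) → x ∉ xs
  Unique-++-∷⇒∉ (y ∷ xs) (y∉ ∷ _) (here refl) = All.lookup y∉ (∈-++⁺ʳ xs (here refl)) refl
  Unique-++-∷⇒∉ (y ∷ xs) (_ ∷ !xs) (there x∈) = Unique-++-∷⇒∉ xs !xs x∈

  Unique-ʳ++⁻ʳ : ∀ (xs : List A) {ys} → Unique (xs ʳ++ ys) → Unique ys
  Unique-ʳ++⁻ʳ []       !ys = !ys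
  Unique-ʳ++⁻ʳ (x ∷ xs) !   with Unique-ʳ++⁻ʳ xs !
  ... | _ ∷ !ys = !ys

  Unique-ʳ++⇒∉ : ∀ (xs : List A) {ys x} → Unique (xs ʳ++ ys) → x ∈ xs → x ∉ ys
  Unique-ʳ++⇒∉ (x ∷ xs) ! (here refl) x∈ys with Unique-ʳ++⁻ʳ xs !
  ... | x∉ys ∷ _ = All.lookup x∉ys x∈ys refl
  Unique-ʳ++⇒∉ (_ ∷ xs) ! (there x∈xs) x∈ys = Unique-ʳ++⇒∉ xs ! x∈xs (there x∈ys)

  Unique-map : ∀ {B : Set} {f : A → B} {xs} → Unique xs →
               (∀ {x y} → x ∈ xs → y ∈ xs → x ≢ y → f x ≢ f y) → Unique (map f xs)
  Unique-map []          _   = []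
  Unique-map {f = f} (x∉ ∷ !xs) inj =
      All.map⁺ (All.tabulate λ y∈ → inj (here refl) (there y∈) (All.lookup x∉ y∈))
    ∷ Unique-map !xs λ x∈ y∈ → inj (there x∈) (there y∈)

  length-concatMap-≥ : ∀ {B : Set} {f : A → List B} {c} xs → (∀ x → c ≤ length (f x)) →
                       length xs * c ≤ length (concatMap f xs)
  length-concatMap-≥ []       _  = z≤n
  length-concatMap-≥ {f = f} (x ∷ xs) c≤ =
    subst (_ ≤_) (sym (length-++ (f x))) (+-mono-≤ (c≤ x) (length-concatMap-≥ xs c≤))

  length-∷ʳ : ∀ (xs : List A) {x} → length (xs ++ x ∷ []) ≡ suc (length xs)
  length-∷ʳ []       = refl
  length-∷ʳ (_ ∷ xs) = cong suc (length-∷ʳ xs)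

  module _ {P : A → Set} {c : ℕ} (card : HasCard P c) where

    private
      ℓ = proj₁ card
      !ℓ = proj₁ (proj₂ card)
      ∈ℓ⇔ = proj₁ (proj₂ (proj₂ card))
      |ℓ| = proj₂ (proj₂ (proj₂ card))

    length≤HasCard : ∀ {xs} → Unique xs → (∀ {x} → x ∈ xs → P x) → length xs ≤ c
    length≤HasCard !xs xs⊆P = subst (_ ≤_) |ℓ|
      (Unique-⊆⇒length≤ !xs λ {x} x∈xs → Equivalence.from (∈ℓ⇔ x) (xs⊆P x∈xs))

    HasCard≤length : ∀ {xs} → (∀ {x} → P x → x ∈ xs) → c ≤ length xs
    HasCard≤length P⊆xs = subst (_≤ _) |ℓ|
      (Unique-⊆⇒length≤ !ℓ λ {x} x∈ℓ → P⊆xs (Equivalence.to (∈ℓ⇔ x) x∈ℓ))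

    HasCard-tight : (∀ x → Dec (P x)) → ∀ {xs} → (∀ {x} → P x → x ∈ xs) → length xs ≤ c →
                        ∀ {x} → x ∈ xs → P x
    HasCard-tight P? {xs} P⊆xs |xs|≤c {x} x∈xs with P? x
    ... | yes Px = Px
    ... | no ¬Px = ⊥-elim (<⇒≱ (subst (_< _) |ℓ| (Unique-⊆⇒length≤ !xℓ xℓ⊆xs)) |xs|≤c)
      where
      !xℓ : Unique (x ∷ ℓ)
      !xℓ = ∉-Unique⇒Unique-∷ (λ x∈ℓ → ¬Px (Equivalence.to (∈ℓ⇔ x) x∈ℓ)) !ℓ
      xℓ⊆xs : x ∷ ℓ ⊆ xs
      xℓ⊆xs (here refl)  = x∈xs
      xℓ⊆xs (there y∈ℓ) = P⊆xs (Equivalence.to (∈ℓ⇔ _) y∈ℓ)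

indicator : ∀ {P : Set} → Dec P → ℕ
indicator P? with does P?
... | true  = 1
... | false = 0

count : ∀ {m} {P : Pred (Fin m) 0ℓ} → Decidable P → ℕ
count {m} P? = sum λ i → indicator (P? i)

length-filter-tabulate : ∀ {m} {A : Set} {P : Pred A 0ℓ} (P? : Decidable P) (f : Fin m → A) →
                         length (filter P? (tabulate f)) ≡ sum (λ i → indicator (P? (f i)))
length-filter-tabulate {zero}  P? f = refl
length-filter-tabulate {suc m} P? f with does (P? (f zero))
... | true  = cong suc (length-filter-tabulate P? (λ i → f (suc i)))
... | false = length-filter-tabulate P? (λ i → f (suc i))

count-HasCard : ∀ {m} {P : Pred (Fin m) 0ℓ} (P? : Decidable P) → HasCard P (count P?)
count-HasCard {m} P? =
    filter P? (allFin m)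
  , filter⁺ P? {allFin m} (allFin⁺ m)
  , (λ x → mk⇔ (λ x∈ → proj₂ (∈-filter⁻ P? {xs = allFin m} x∈)) (∈-filter⁺ P? (∈-allFin x)))
  , length-filter-tabulate P? (λ i → i)

sum-mono-≤ : ∀ {m} {f h : Fin m → ℕ} → (∀ i → f i ≤ h i) → sum f ≤ sum h
sum-mono-≤ {zero}  f≤h = z≤n
sum-mono-≤ {suc m} f≤h = +-mono-≤ (f≤h zero) (sum-mono-≤ (λ i → f≤h (suc i)))

sum-rigid : ∀ {m} {f h : Fin m → ℕ} → (∀ i → f i ≤ h i) → sum h ≤ sum f → ∀ i → f i ≡ h i
sum-rigid {suc m} {f} {h} f≤h ∑h≤∑f = go
  where
  tail≤ : sum (λ i → f (suc i)) ≤ sum (λ i → h (suc i))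
  tail≤ = sum-mono-≤ (λ i → f≤h (suc i))
  go : ∀ i → f i ≡ h i
  go zero    = ≤-antisym (f≤h zero) (+-cancelʳ-≤ _ _ _ (≤-trans ∑h≤∑f (+-monoʳ-≤ (f zero) tail≤)))
  go (suc i) = sum-rigid (λ i → f≤h (suc i))
                 (+-cancelˡ-≤ (h zero) _ _ (≤-trans ∑h≤∑f (+-monoˡ-≤ _ (f≤h zero)))) i

sum-const : ∀ m c → sum {m} (λ _ → c) ≡ m * c
sum-const zero    c = refl
sum-const (suc m) c = cong (c +_) (sum-const m c)

double-counting-rigid :
  ∀ {M N} {R : Fin M → Fin N → Set} (R? : ∀ i v → Dec (R i v)) {r c} → N * c ≡ M * r →
  (∀ i → r ≤ count (R? i)) → (∀ v → count (λ i → R? i v) ≤ c) →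
  (∀ i → count (R? i) ≡ r) × (∀ v → count (λ i → R? i v) ≡ c)
double-counting-rigid {M} {N} R? {r} {c} Nc≡Mr r≤row col≤c =
  (λ i → sym (sum-rigid r≤row rows≤ i)) , sum-rigid col≤c cols≤
  where
  rows≡cols : sum (λ i → count (R? i)) ≡ sum (λ v → count (λ i → R? i v))
  rows≡cols = ∑-comm (λ i v → indicator (R? i v))
  ∑c≡∑r : sum {N} (λ _ → c) ≡ sum {M} (λ _ → r)
  ∑c≡∑r = trans (sum-const N c) (trans Nc≡Mr (sym (sum-const M r)))
  rows≤ : sum (λ i → count (R? i)) ≤ sum {M} (λ _ → r)
  rows≤ = ≤-trans (≤-reflexive rows≡cols) (≤-trans (sum-mono-≤ col≤c) (≤-reflexive ∑c≡∑r))
  cols≤ : sum {N} (λ _ → c) ≤ sum (λ v → count (λ i → R? i v))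
  cols≤ = ≤-trans (≤-reflexive ∑c≡∑r) (≤-trans (sum-mono-≤ r≤row) (≤-reflexive rows≡cols))

-- Walks and balls

least : ∀ {P : Pred ℕ 0ℓ} → Decidable P → ∀ {l} → P l → ∃[ m ] P m × (∀ {l} → P l → m ≤ l)
least P? {zero} P0 = zero , P0 , λ _ → z≤n
least {P} P? {suc l} Pl with P? zero
... | yes P0 = zero , P0 , λ _ → z≤n
... | no ¬P0 with least (λ l → P? (suc l)) Pl
...   | m , Psm , m-min = suc m , Psm , minimal
  where
  minimal : ∀ {l} → P l → suc m ≤ l
  minimal {zero}  P0  = ⊥-elim (¬P0 P0)
  minimal {suc l} Psl = s≤s (m-min Psl)

module _ (G : Graph) where

  private
    V = Fin (n G)

  walk-snoc : ∀ {u v w l} → Walk G u v l → Adj G v w → Walk G u w (suc l)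
  walk-snoc (nil _)    e = cons e (nil _)
  walk-snoc (cons e w) f = cons e (walk-snoc w f)

  walk-++ : ∀ {u v w l m} → Walk G u v l → Walk G v w m → Walk G u w (l + m)
  walk-++ (nil _)    w = w
  walk-++ (cons e w) x = cons e (walk-++ w x)

  walk-reverse : ∀ {u v l} → Walk G u v l → Walk G v u l
  walk-reverse (nil _)    = nil _
  walk-reverse (cons e w) = walk-snoc (walk-reverse w) (Graph.sym G e)

  walk? : ∀ l u v → Dec (Walk G u v l)
  walk? zero u v with u ≟ᶠ v
  ... | yes refl = yes (nil u)
  ... | no u≢v   = no λ { (nil _) → u≢v refl }
  walk? (suc l) u v = map′ (λ (w , e , p) → cons e p) (λ { (cons e p) → _ , e , p })
                           (any? λ w → adj? G u w ×-dec walk? l w v)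

  walk⇒InBall : ∀ {k u v l} → l ≤ k → Walk G u v l → InBall G k u v
  walk⇒InBall {u = u} {v} l≤k w with least (λ l → walk? l u v) w
  ... | d , shortest , minimal = d , (shortest , λ _ → minimal) , ≤-trans (minimal w) l≤k

  InBall? : ∀ k u v → Dec (InBall G k u v)
  InBall? k u v = map′ (λ (i , w) → walk⇒InBall (s≤s⁻¹ (toℕ<n i)) w)
                       (λ (d , (w , _) , d≤k) → fromℕ< (s≤s d≤k) , subst (Walk G u v) (sym (toℕ-fromℕ< _)) w)
                       (any? λ (i : Fin (suc k)) → walk? (toℕ i) u v)

  InBall-common : ∀ {k u w v} → InBall G k u v → InBall G k w v → ∃[ l ] l ≤ k + k × Walk G u w l
  InBall-common (d , (p , _) , d≤k) (d′ , (p′ , _) , d′≤k) =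
    d + d′ , +-mono-≤ d≤k d′≤k , walk-++ p (walk-reverse p′)

-- Non-backtracking walks and short cycles

module Cycles (G : Graph) where

  private
    V = Fin (n G)

  open import Data.List.Membership.DecPropositional (_≟ᶠ_ {n G}) using (_∈?_)
  open import Data.List.Relation.Unary.Unique.DecPropositional (_≟ᶠ_ {n G}) using (unique?)

  CycleShorterThan : ℕ → Set
  CycleShorterThan B = ∃[ m ] m < B × Σ (Fin m → V) (IsCycle G m)

  _≢head_ : V → List V → Set
  x ≢head []      = ⊤
  x ≢head (y ∷ _) = x ≢ y

  HeadsDiffer : List V → List V → Set
  HeadsDiffer []      _  = ⊤
  HeadsDiffer (x ∷ _) ys = x ≢head ys

  NonBacktracking : List V → Set
  NonBacktracking (x ∷ y ∷ ys) = Adj G x y × x ≢head ys × NonBacktracking (y ∷ ys)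
  NonBacktracking _            = ⊤

  ≢head-++ : ∀ {x} xs {ys} → x ≢head (xs ++ ys) → x ≢head xs
  ≢head-++ []      _   = tt
  ≢head-++ (_ ∷ _) x≢y = x≢y

  ≢head⇒HeadsDiffer : ∀ {a} xs {as} → a ≢head xs → HeadsDiffer xs (a ∷ as)
  ≢head⇒HeadsDiffer []      _   = tt
  ≢head⇒HeadsDiffer (_ ∷ _) a≢x = λ x≡a → a≢x (sym x≡a)

  NonBacktracking-tail : ∀ {x} xs → NonBacktracking (x ∷ xs) → NonBacktracking xs
  NonBacktracking-tail []      _            = tt
  NonBacktracking-tail (_ ∷ _) (_ , _ , nb) = nb

  NonBacktracking-++⁻ˡ : ∀ xs {ys} → NonBacktracking (xs ++ ys) → NonBacktracking xs
  NonBacktracking-++⁻ˡ []           _               = tt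
  NonBacktracking-++⁻ˡ (_ ∷ [])     _               = tt
  NonBacktracking-++⁻ˡ (x ∷ y ∷ xs) (x~y , x≢ , nb) = x~y , ≢head-++ xs x≢ , NonBacktracking-++⁻ˡ (y ∷ xs) nb

  NonBacktracking-++⁻ʳ : ∀ xs {ys} → NonBacktracking (xs ++ ys) → NonBacktracking ys
  NonBacktracking-++⁻ʳ []       nb = nb
  NonBacktracking-++⁻ʳ (_ ∷ xs) nb = NonBacktracking-++⁻ʳ xs (NonBacktracking-tail (xs ++ _) nb)

  NonBacktracking-ʳ++ : ∀ {a} xs {as} → NonBacktracking (a ∷ xs) → NonBacktracking (a ∷ as) →
                        HeadsDiffer xs as → NonBacktracking (xs ʳ++ (a ∷ as))
  NonBacktracking-ʳ++ []       _                    nbas _   = nbas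
  NonBacktracking-ʳ++ (x ∷ xs) (a~x , a≢xs , nbxs) nbas x≢as =
    NonBacktracking-ʳ++ xs nbxs (Graph.sym G a~x , x≢as , nbas) (≢head⇒HeadsDiffer xs a≢xs)

  lookup-injective : ∀ {xs : List V} → Unique xs → ∀ {i j} → lookup xs i ≡ lookup xs j → i ≡ j
  lookup-injective {_ ∷ _}  (x∉ ∷ !xs) {zero}  {zero}  _ = refl
  lookup-injective {_ ∷ _}  (x∉ ∷ !xs) {zero}  {suc j} e = ⊥-elim (All.lookup x∉ (∈-lookup j) e)
  lookup-injective {_ ∷ _}  (x∉ ∷ !xs) {suc i} {zero}  e = ⊥-elim (All.lookup x∉ (∈-lookup i) (sym e))
  lookup-injective {_ ∷ _}  (x∉ ∷ !xs) {suc i} {suc j} e = cong suc (lookup-injective !xs e)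

  NonBacktracking-lookup : ∀ xs → NonBacktracking xs → ∀ (i j : Fin (length xs)) →
                           toℕ j ≡ suc (toℕ i) → Adj G (lookup xs i) (lookup xs j)
  NonBacktracking-lookup (_ ∷ _ ∷ _) (x~y , _) zero    (suc zero) _ = x~y
  NonBacktracking-lookup (_ ∷ xs)    nb        (suc i) (suc j)    e =
    NonBacktracking-lookup xs (NonBacktracking-tail xs nb) i j (suc-injective e)
  NonBacktracking-lookup (_ ∷ _ ∷ _) _ zero    (suc (suc _)) ()
  NonBacktracking-lookup (_ ∷ _)     _ zero    zero          ()
  NonBacktracking-lookup (_ ∷ _)     _ (suc _) zero          ()

  NonBacktracking-lookup-last : ∀ xs {x} → NonBacktracking (xs ++ x ∷ []) → ∀ (i : Fin (length xs)) →
                                suc (toℕ i) ≡ length xs → Adj G (lookup xs i) x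
  NonBacktracking-lookup-last (_ ∷ [])     (y~x , _) zero    _ = y~x
  NonBacktracking-lookup-last (_ ∷ xs)     nb        (suc i) e =
    NonBacktracking-lookup-last xs (NonBacktracking-tail (xs ++ _) nb) i (suc-injective e)
  NonBacktracking-lookup-last (_ ∷ _ ∷ _) _ zero ()

  closed-walk-IsCycle : ∀ x s → NonBacktracking (x ∷ s ++ x ∷ []) → x ∉ s → Unique s →
                        IsCycle G (suc (length s)) (lookup (x ∷ s))
  closed-walk-IsCycle x []          (x~x , _)     _ _ = ⊥-elim (irrefl G x~x)
  closed-walk-IsCycle x (_ ∷ [])    (_ , x≢x , _) _ _ = ⊥-elim (x≢x refl)
  closed-walk-IsCycle x s@(_ ∷ _ ∷ _) nb x∉s !s =
    s≤s (s≤s (s≤s z≤n)) , lookup-injective (∉-Unique⇒Unique-∷ x∉s !s) , adjacent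
    where
    adjacent : ∀ i → Adj G (lookup (x ∷ s) i) (lookup (x ∷ s) (next i))
    adjacent i with m≤n⇒m<n∨m≡n (toℕ<n i)
    ... | inj₁ i+1<m = NonBacktracking-lookup (x ∷ s) (NonBacktracking-++⁻ˡ (x ∷ s) nb) i (next i)
                         (trans (toℕ-fromℕ< _) (m<n⇒m%n≡m i+1<m))
    ... | inj₂ i+1≡m = subst (λ j → Adj G (lookup (x ∷ s) i) (lookup (x ∷ s) j)) (sym next-i≡0)
                         (NonBacktracking-lookup-last (x ∷ s) nb i i+1≡m)
      where
      next-i≡0 : next i ≡ zero
      next-i≡0 = toℕ-injective (trans (toℕ-fromℕ< _) (trans (cong (_% suc (length s)) i+1≡m) (n%n≡0 (suc (length s)))))

  CycleShorterThan-mono : ∀ {B B′} → B ≤ B′ → CycleShorterThan B → CycleShorterThan B′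
  CycleShorterThan-mono B≤B′ (m , m<B , c) = m , <-≤-trans m<B B≤B′ , c

  repeat⇒cycle : ∀ xs → NonBacktracking xs → ¬ Unique xs → CycleShorterThan (length xs)
  repeat⇒cycle []       _  ¬! = ⊥-elim (¬! [])
  repeat⇒cycle (x ∷ xs) nb ¬! with unique? xs
  ... | no ¬!xs = CycleShorterThan-mono (n≤1+n _) (repeat⇒cycle xs (NonBacktracking-tail xs nb) ¬!xs)
  ... | yes !xs with x ∈? xs
  ...   | no x∉xs  = ⊥-elim (¬! (∉-Unique⇒Unique-∷ x∉xs !xs))
  ...   | yes x∈xs with ∈-∃++ x∈xs
  ...     | s , t , refl =
      suc (length s) , s≤s |s|<|xs| , lookup (x ∷ s)
    , closed-walk-IsCycle x s first-return (Unique-++-∷⇒∉ s !xs) (Unique-++⁻ˡ s !xs)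
    where
    first-return : NonBacktracking (x ∷ s ++ x ∷ [])
    first-return = NonBacktracking-++⁻ˡ (x ∷ s ++ x ∷ []) (subst NonBacktracking (cong (x ∷_) (sym (++-assoc s (x ∷ []) t))) nb)
    |s|<|xs| : length s < length (s ++ x ∷ t)
    |s|<|xs| = subst (length s <_) (sym (length-++ s)) (m<m+n (length s) (s≤s z≤n))

  headOr : V → List V → V
  headOr x []      = x
  headOr _ (y ∷ _) = y

  headOr-≢ : ∀ {x} r r′ → headOr x r ≢ headOr x r′ → HeadsDiffer (r ++ x ∷ []) (r′ ++ x ∷ [])
  headOr-≢ []      []      d = d
  headOr-≢ []      (_ ∷ _) d = d
  headOr-≢ (_ ∷ _) []      d = d
  headOr-≢ (_ ∷ _) (_ ∷ _) d = d

  return⇒cycle : ∀ {x} r → NonBacktracking (x ∷ r ++ x ∷ []) → CycleShorterThan (suc (suc (length r)))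
  return⇒cycle {x} r nb = CycleShorterThan-mono (≤-reflexive (cong suc (length-∷ʳ r)))
    (repeat⇒cycle (x ∷ r ++ x ∷ []) nb λ { (x∉ ∷ _) → All.lookup x∉ (∈-++⁺ʳ r (here refl)) refl })

  -- A list r ++ [x] is a walk from x listed backwards, ending at headOr x r.  After stripping
  -- the common final segment, two such walks leave one vertex along different edges, and the
  -- reverse of one followed by the other is a non-backtracking walk repeating a vertex.
  distinct-walks⇒cycle : ∀ {x} r r′ → NonBacktracking (r ++ x ∷ []) → NonBacktracking (r′ ++ x ∷ []) →
                         headOr x r ≡ headOr x r′ → r ≢ r′ → CycleShorterThan (suc (length r + length r′))
  distinct-walks⇒cycle []      []       _  _   _    r≢r′ = ⊥-elim (r≢r′ refl)
  distinct-walks⇒cycle     []      (y ∷ r′) _  nb′ refl _ = return⇒cycle r′ nb′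
  distinct-walks⇒cycle     (y ∷ r) []       nb _   refl _ =
    CycleShorterThan-mono (≤-reflexive (cong (λ l → suc (suc l)) (sym (+-identityʳ (length r))))) (return⇒cycle r nb)
  distinct-walks⇒cycle {x} (y ∷ r) (.y ∷ r′) nb nb′ refl r≢r′ with headOr x r ≟ᶠ headOr x r′
  ... | yes same = CycleShorterThan-mono (s≤s (≤-trans (+-monoʳ-≤ (length r) (n≤1+n _)) (n≤1+n _)))
                     (distinct-walks⇒cycle r r′ (NonBacktracking-tail (r ++ _) nb) (NonBacktracking-tail (r′ ++ _) nb′)
                       same (λ r≡r′ → r≢r′ (cong (y ∷_) r≡r′)))
  ... | no differ =
    CycleShorterThan-mono (≤-reflexive |glued|)
      (repeat⇒cycle ((r ++ x ∷ []) ʳ++ (y ∷ r′ ++ x ∷ []))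
        (NonBacktracking-ʳ++ (r ++ x ∷ []) nb nb′ (headOr-≢ r r′ differ))
        (λ ! → Unique-ʳ++⇒∉ (r ++ x ∷ []) ! (∈-++⁺ʳ r (here refl)) (there (∈-++⁺ʳ r′ (here refl)))))
    where
    |glued| : length ((r ++ x ∷ []) ʳ++ (y ∷ r′ ++ x ∷ [])) ≡ suc (suc (length r + suc (length r′)))
    |glued| = begin
      length ((r ++ x ∷ []) ʳ++ (y ∷ r′ ++ x ∷ []))      ≡⟨ length-ʳ++ (r ++ x ∷ []) ⟩
      length (r ++ x ∷ []) + suc (length (r′ ++ x ∷ [])) ≡⟨ cong₂ (λ a b → a + suc b) (length-∷ʳ r) (length-∷ʳ r′) ⟩
      suc (length r + suc (suc (length r′)))             ≡⟨ cong suc (+-suc (length r) (suc (length r′))) ⟩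
      suc (suc (length r + suc (length r′)))             ∎
      where open ≡-Reasoning

  headOr-++ : ∀ d r {x t} → headOr d (r ++ x ∷ t) ≡ headOr x r
  headOr-++ _ []      = refl
  headOr-++ _ (_ ∷ _) = refl

  NonBacktracking-++-∷⁻ : ∀ r {x t} → NonBacktracking (r ++ x ∷ t) → NonBacktracking (r ++ x ∷ [])
  NonBacktracking-++-∷⁻ r {x} {t} nb =
    NonBacktracking-++⁻ˡ (r ++ x ∷ []) (subst NonBacktracking (sym (++-assoc r (x ∷ []) t)) nb)

  NonBacktracking⇒Walk : ∀ r {x t} → NonBacktracking (r ++ x ∷ t) → Walk G (headOr x r) x (length r)
  NonBacktracking⇒Walk []          _              = nil _
  NonBacktracking⇒Walk (_ ∷ [])    (y~x , _ , _)  = cons y~x (nil _)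
  NonBacktracking⇒Walk (_ ∷ z ∷ r) (y~z , _ , nb) = cons y~z (NonBacktracking⇒Walk (z ∷ r) nb)

-- Lower bounds on the size of balls

tree-size : ℕ → ℕ → ℕ
tree-size d zero    = 1
tree-size d (suc k) = suc (d * tree-size d k)

tree-size-suc : ∀ d k → tree-size d (suc k) ≡ tree-size d k + d ^ suc k
tree-size-suc d zero    = refl
tree-size-suc d (suc k) = begin
  suc (d * tree-size d (suc k))                  ≡⟨ cong (λ t → suc (d * t)) (tree-size-suc d k) ⟩
  suc (d * (tree-size d k + d ^ suc k))          ≡⟨ cong suc (*-distribˡ-+ d (tree-size d k) (d ^ suc k)) ⟩
  suc (d * tree-size d k + d * d ^ suc k)        ∎
  where open ≡-Reasoning

sumOdd≡δ*tree-size : ∀ δ k → sumOdd δ (suc k) ≡ δ * tree-size (δ ∸ 1) k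
sumOdd≡δ*tree-size δ zero    = refl
sumOdd≡δ*tree-size δ (suc k) = begin
  sumOdd δ (suc k) + δ * (δ ∸ 1) ^ suc k               ≡⟨ cong (_+ δ * (δ ∸ 1) ^ suc k) (sumOdd≡δ*tree-size δ k) ⟩
  δ * tree-size (δ ∸ 1) k + δ * (δ ∸ 1) ^ suc k        ≡⟨ sym (*-distribˡ-+ δ _ _) ⟩
  δ * (tree-size (δ ∸ 1) k + (δ ∸ 1) ^ suc k)          ≡⟨ cong (δ *_) (sym (tree-size-suc (δ ∸ 1) k)) ⟩
  δ * tree-size (δ ∸ 1) (suc k)                        ∎
  where open ≡-Reasoning

sumEven≡2*tree-size : ∀ δ k → 2 + sumEven δ k ≡ tree-size (δ ∸ 1) k + tree-size (δ ∸ 1) k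
sumEven≡2*tree-size δ zero    = refl
sumEven≡2*tree-size δ (suc k) = begin
  2 + (sumEven δ k + 2 * p)     ≡⟨ sym (+-assoc 2 (sumEven δ k) (2 * p)) ⟩
  2 + sumEven δ k + 2 * p       ≡⟨ cong (_+ 2 * p) (sumEven≡2*tree-size δ k) ⟩
  t + t + 2 * p                 ≡⟨ solve 2 (λ t p → t :+ t :+ con 2 :* p := (t :+ p) :+ (t :+ p)) refl t p ⟩
  (t + p) + (t + p)             ≡⟨ sym (cong₂ _+_ (tree-size-suc (δ ∸ 1) k) (tree-size-suc (δ ∸ 1) k)) ⟩
  tree-size (δ ∸ 1) (suc k) + tree-size (δ ∸ 1) (suc k) ∎
  where
  open ≡-Reasoning
  open +-*-Solver
  t = tree-size (δ ∸ 1) k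
  p = (δ ∸ 1) ^ suc k

module MooreBound (G : Graph) {δ : ℕ} (degree : ∀ v → Σ ℕ λ d → HasCard (Adj G v) d × δ ≤ d) where

  open Cycles G

  private
    V = Fin (n G)

  neighbours : V → List V
  neighbours v = proj₁ (proj₁ (proj₂ (degree v)))

  neighbours-Unique : ∀ v → Unique (neighbours v)
  neighbours-Unique v = proj₁ (proj₂ (proj₁ (proj₂ (degree v))))

  ∈-neighbours⇒Adj : ∀ {v w} → w ∈ neighbours v → Adj G v w
  ∈-neighbours⇒Adj {v} {w} = Equivalence.to (proj₁ (proj₂ (proj₂ (proj₁ (proj₂ (degree v))))) w)

  δ≤|neighbours| : ∀ v → δ ≤ length (neighbours v)
  δ≤|neighbours| v with degree v
  ... | _ , (_ , _ , _ , |ℓ|≡d) , δ≤d = subst (δ ≤_) (sym |ℓ|≡d) δ≤d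

  _≢head?_ : ∀ z xs → Dec (z ≢head xs)
  z ≢head? []      = yes tt
  z ≢head? (y ∷ _) = ¬? (z ≟ᶠ y)

  successors : List V → List V
  successors []       = []
  successors (x ∷ xs) = filter (_≢head? xs) (neighbours x)

  successors-Unique : ∀ xs → Unique (successors xs)
  successors-Unique []       = []
  successors-Unique (x ∷ xs) = filter⁺ (_≢head? xs) (neighbours-Unique x)

  ∈-successors : ∀ {z} xs → z ∈ successors xs → NonBacktracking xs → NonBacktracking (z ∷ xs)
  ∈-successors (x ∷ xs) z∈ nb with ∈-filter⁻ (_≢head? xs) {xs = neighbours x} z∈
  ... | z∈N , z≢ = Graph.sym G (∈-neighbours⇒Adj z∈N) , z≢ , nb

  δ≤|successors-root| : ∀ x → δ ≤ length (successors (x ∷ []))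
  δ≤|successors-root| x = subst (δ ≤_) (cong length (sym (filter-all (_≢head? []) {neighbours x} (All.tabulate λ _ → tt))))
                                 (δ≤|neighbours| x)

  δ∸1≤|successors| : ∀ x xs → δ ∸ 1 ≤ length (successors (x ∷ xs))
  δ∸1≤|successors| x []       = ≤-trans (m∸n≤m δ 1) (δ≤|successors-root| x)
  δ∸1≤|successors| x (y ∷ ys) = begin
    δ ∸ 1                                  ≤⟨ ∸-monoˡ-≤ 1 (δ≤|neighbours| x) ⟩
    length (neighbours x) ∸ 1              ≤⟨ ∸-monoˡ-≤ 1 (Unique-⊆⇒length≤ (neighbours-Unique x) N⊆) ⟩
    length (successors (x ∷ y ∷ ys))       ∎
    where
    open ≤-Reasoning
    N⊆ : neighbours x ⊆ y ∷ successors (x ∷ y ∷ ys)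
    N⊆ {z} z∈N with z ≟ᶠ y
    ... | yes refl = here refl
    ... | no z≢y   = there (∈-filter⁺ (_≢head? (y ∷ ys)) z∈N z≢y)

  walks : List V → ℕ → List (List V)
  walks xs zero    = xs ∷ []
  walks xs (suc k) = xs ∷ concatMap (λ z → walks (z ∷ xs) k) (successors xs)

  ∈-walks-suc : ∀ xs k {w} → w ∈ concatMap (λ z → walks (z ∷ xs) k) (successors xs) →
                ∃[ z ] z ∈ successors xs × w ∈ walks (z ∷ xs) k
  ∈-walks-suc xs k w∈ with ∈-concat⁻′ (map (λ z → walks (z ∷ xs) k) (successors xs)) w∈
  ... | ws , w∈ws , ws∈ with ∈-map⁻ (λ z → walks (z ∷ xs) k) ws∈
  ... | z , z∈ , refl = z , z∈ , w∈ws

  ∈-walks⇒suffix : ∀ xs k {w} → w ∈ walks xs k → ∃[ r ] w ≡ r ++ xs × length r ≤ k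
  ∈-walks⇒suffix xs zero    (here refl) = [] , refl , z≤n
  ∈-walks⇒suffix xs (suc k) (here refl) = [] , refl , z≤n
  ∈-walks⇒suffix xs (suc k) (there w∈) with ∈-walks-suc xs k w∈
  ... | z , _ , w∈′ with ∈-walks⇒suffix (z ∷ xs) k w∈′
  ... | r , refl , |r|≤k = r ++ z ∷ [] , sym (++-assoc r (z ∷ []) xs) , ≤-trans (≤-reflexive (length-∷ʳ r)) (s≤s |r|≤k)

  ∈-walks⇒NonBacktracking : ∀ xs k {w} → NonBacktracking xs → w ∈ walks xs k → NonBacktracking w
  ∈-walks⇒NonBacktracking xs zero    nb (here refl) = nb
  ∈-walks⇒NonBacktracking xs (suc k) nb (here refl) = nb
  ∈-walks⇒NonBacktracking xs (suc k) nb (there w∈) with ∈-walks-suc xs k w∈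
  ... | z , z∈ , w∈′ = ∈-walks⇒NonBacktracking (z ∷ xs) k (∈-successors xs z∈ nb) w∈′

  walks-Unique : ∀ xs k → Unique (walks xs k)
  walks-Unique xs zero    = [] ∷ []
  walks-Unique xs (suc k) =
      All.tabulate root-first
    ∷ concat⁺ (All.map⁺ (All.tabulate λ {z} _ → walks-Unique (z ∷ xs) k))
              (AllPairs.map⁺ (AllPairs.map disjoint (successors-Unique xs)))
    where
    root-first : ∀ {w} → w ∈ concatMap (λ z → walks (z ∷ xs) k) (successors xs) → xs ≢ w
    root-first {w} w∈ xs≡w with ∈-walks-suc xs k w∈
    ... | z , _ , w∈′ with ∈-walks⇒suffix (z ∷ xs) k w∈′
    ... | r , w≡ , _ = <-irrefl (cong length xs≡w) (begin-strict
      length xs                ≤⟨ m≤n+m (length xs) (length r) ⟩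
      length r + length xs     <⟨ +-monoʳ-< (length r) (n<1+n (length xs)) ⟩
      length r + length (z ∷ xs) ≡⟨ sym (length-++ r) ⟩
      length (r ++ z ∷ xs)     ≡⟨ cong length (sym w≡) ⟩
      length w                 ∎)
      where open ≤-Reasoning
    disjoint : ∀ {z z′} → z ≢ z′ → Disjoint (walks (z ∷ xs) k) (walks (z′ ∷ xs) k)
    disjoint z≢z′ (w∈ , w∈′) with ∈-walks⇒suffix _ k w∈ | ∈-walks⇒suffix _ k w∈′
    ... | r , refl , _ | r′ , w≡ , _ =
      z≢z′ (∷ʳ-injectiveʳ r r′ (++-cancelʳ xs (r ++ _ ∷ []) (r′ ++ _ ∷ [])
        (trans (++-assoc r _ xs) (trans w≡ (sym (++-assoc r′ _ xs))))))

  ∈-walks : ∀ xs k {w} → NonBacktracking xs → w ∈ walks xs k →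
            ∃[ r ] w ≡ r ++ xs × length r ≤ k × NonBacktracking w
  ∈-walks xs k nb w∈ with ∈-walks⇒suffix xs k w∈
  ... | r , w≡ , |r|≤k = r , w≡ , |r|≤k , ∈-walks⇒NonBacktracking xs k nb w∈

  ∈-walks⇒InBall : ∀ x t k → NonBacktracking (x ∷ t) → ∀ {w} → w ∈ walks (x ∷ t) k → ∀ d → InBall G k x (headOr d w)
  ∈-walks⇒InBall x t k nb w∈ d with ∈-walks (x ∷ t) k nb w∈
  ... | r , refl , |r|≤k , nbw = subst (InBall G k x) (sym (headOr-++ d r))
    (walk⇒InBall G |r|≤k (walk-reverse G (NonBacktracking⇒Walk r nbw)))

  tree-size≤|walks| : ∀ x xs k → tree-size (δ ∸ 1) k ≤ length (walks (x ∷ xs) k)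
  tree-size≤|walks| x xs zero    = ≤-refl
  tree-size≤|walks| x xs (suc k) = s≤s (begin
    (δ ∸ 1) * tree-size (δ ∸ 1) k                        ≤⟨ *-monoˡ-≤ _ (δ∸1≤|successors| x xs) ⟩
    length (successors (x ∷ xs)) * tree-size (δ ∸ 1) k   ≤⟨ length-concatMap-≥ (successors (x ∷ xs))
                                                              (λ z → tree-size≤|walks| z (x ∷ xs) k) ⟩
    length (concatMap (λ z → walks (z ∷ x ∷ xs) k) (successors (x ∷ xs))) ∎)
    where open ≤-Reasoning

  Moore-odd≤|walks| : ∀ x k → 1 + sumOdd δ k ≤ length (walks (x ∷ []) k)
  Moore-odd≤|walks| x zero    = ≤-refl
  Moore-odd≤|walks| x (suc k) = s≤s (begin
    sumOdd δ (suc k)                                  ≡⟨ sumOdd≡δ*tree-size δ k ⟩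
    δ * tree-size (δ ∸ 1) k                           ≤⟨ *-monoˡ-≤ _ (δ≤|successors-root| x) ⟩
    length (successors (x ∷ [])) * tree-size (δ ∸ 1) k ≤⟨ length-concatMap-≥ (successors (x ∷ []))
                                                           (λ z → tree-size≤|walks| z (x ∷ []) k) ⟩
    length (concatMap (λ z → walks (z ∷ x ∷ []) k) (successors (x ∷ []))) ∎)
    where open ≤-Reasoning

  module _ {L : ℕ} (long : ∀ m c → IsCycle G m c → L ≤ m) (k : ℕ) where

    distinct-short-walks : ∀ {x} r r′ → NonBacktracking (r ++ x ∷ []) → NonBacktracking (r′ ++ x ∷ []) →
                           r ≢ r′ → length r + length r′ < L → headOr x r ≢ headOr x r′
    distinct-short-walks r r′ nb nb′ r≢r′ short same with distinct-walks⇒cycle r r′ nb nb′ same r≢r′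
    ... | m , m<B , c , isCycle = <⇒≱ (<-≤-trans m<B short) (long m c isCycle)

    walks-endpoint-injective : ∀ {x t} d → k + k < L → NonBacktracking (x ∷ t) →
                               ∀ {p q} → p ∈ walks (x ∷ t) k → q ∈ walks (x ∷ t) k → p ≢ q → headOr d p ≢ headOr d q
    walks-endpoint-injective {x} {t} d 2k<L nb p∈ q∈ p≢q with ∈-walks _ k nb p∈ | ∈-walks _ k nb q∈
    ... | r , refl , |r|≤k , nbp | r′ , refl , |r′|≤k , nbq = λ same →
      distinct-short-walks r r′ (NonBacktracking-++-∷⁻ r nbp) (NonBacktracking-++-∷⁻ r′ nbq)
        (λ r≡r′ → p≢q (cong (_++ x ∷ t) r≡r′)) (≤-<-trans (+-mono-≤ |r|≤k |r′|≤k) 2k<L)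
        (trans (sym (headOr-++ d r)) (trans same (headOr-++ d r′)))

    Moore-odd≤|ball| : ∀ u {c} → k + k < L → HasCard (InBall G k u) c → 1 + sumOdd δ k ≤ c
    Moore-odd≤|ball| u {c} 2k<L card = begin
      1 + sumOdd δ k                              ≤⟨ Moore-odd≤|walks| u k ⟩
      length (walks (u ∷ []) k)                   ≡⟨ sym (length-map (headOr u) (walks (u ∷ []) k)) ⟩
      length (map (headOr u) (walks (u ∷ []) k))  ≤⟨ length≤HasCard card
                                                      (Unique-map (walks-Unique (u ∷ []) k) (walks-endpoint-injective u 2k<L tt))
                                                      in-ball ⟩
      c                                           ∎
      where
      open ≤-Reasoning
      in-ball : ∀ {v} → v ∈ map (headOr u) (walks (u ∷ []) k) → InBall G k u v
      in-ball v∈ with ∈-map⁻ (headOr u) v∈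
      ... | p , p∈ , refl = ∈-walks⇒InBall u [] k tt p∈ u

    module _ {u w} (u~w : Adj G u w) where

      private
        nbu : NonBacktracking (u ∷ w ∷ [])
        nbu = u~w , tt , tt
        nbw : NonBacktracking (w ∷ u ∷ [])
        nbw = Graph.sym G u~w , tt , tt

      edge-walks : List (List V)
      edge-walks = walks (u ∷ w ∷ []) k ++ walks (w ∷ u ∷ []) k

      edge-walks-Unique : Unique edge-walks
      edge-walks-Unique = ++⁺ (walks-Unique _ k) (walks-Unique _ k) λ (p∈u , p∈w) → disjoint p∈u p∈w
        where
        disjoint : ∀ {p} → p ∈ walks (u ∷ w ∷ []) k → p ∈ walks (w ∷ u ∷ []) k → ⊥
        disjoint p∈u p∈w with ∈-walks⇒suffix _ k p∈u | ∈-walks⇒suffix _ k p∈w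
        ... | r , refl , _ | r′ , p≡ , _ = irrefl G (subst (Adj G u) w≡u u~w)
          where
          w≡u : w ≡ u
          w≡u = ∷ʳ-injectiveʳ (r ++ u ∷ []) (r′ ++ w ∷ []) (trans (++-assoc r _ _) (trans p≡ (sym (++-assoc r′ _ _))))

      -- r ++ [u, w] and the prefix r′ ++ [w] of r′ ++ [w, u] are distinct walks from w (if they
      -- were equal, r′ ++ [w, u] would backtrack) of total length at most 2k + 1.
      opposite-walks-endpoints : suc (k + k) < L → ∀ {p q} → p ∈ walks (u ∷ w ∷ []) k → q ∈ walks (w ∷ u ∷ []) k →
                                 headOr u p ≢ headOr u q
      opposite-walks-endpoints 2k+1<L p∈ q∈ same with ∈-walks _ k nbu p∈ | ∈-walks _ k nbw q∈
      ... | r , refl , |r|≤k , nbp | r′ , refl , |r′|≤k , nbq =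
        distinct-short-walks (r ++ u ∷ []) r′
          (subst NonBacktracking (sym (++-assoc r (u ∷ []) (w ∷ []))) nbp) (NonBacktracking-++-∷⁻ r′ nbq)
          no-return |r|+1+|r′|<L
          (trans (headOr-++ w r) (trans (sym (headOr-++ u r)) (trans same (headOr-++ u r′))))
        where
        no-return : r ++ u ∷ [] ≢ r′
        no-return refl with NonBacktracking-++⁻ʳ r (subst NonBacktracking (++-assoc r (u ∷ []) (w ∷ u ∷ [])) nbq)
        ... | _ , u≢u , _ = u≢u refl
        |r|+1+|r′|<L : length (r ++ u ∷ []) + length r′ < L
        |r|+1+|r′|<L = ≤-<-trans (≤-trans (≤-reflexive (cong (_+ length r′) (length-∷ʳ r))) (s≤s (+-mono-≤ |r|≤k |r′|≤k))) 2k+1<L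

      edge-walks-endpoint-injective : suc (k + k) < L → ∀ {p q} → p ∈ edge-walks → q ∈ edge-walks → p ≢ q →
                                      headOr u p ≢ headOr u q
      edge-walks-endpoint-injective 2k+1<L p∈ q∈ p≢q with ∈-++⁻ (walks (u ∷ w ∷ []) k) p∈ | ∈-++⁻ (walks (u ∷ w ∷ []) k) q∈
      ... | inj₁ p∈u | inj₁ q∈u = walks-endpoint-injective u 2k<L nbu p∈u q∈u p≢q
        where 2k<L = <-trans (n<1+n (k + k)) 2k+1<L
      ... | inj₂ p∈w | inj₂ q∈w = walks-endpoint-injective u 2k<L nbw p∈w q∈w p≢q
        where 2k<L = <-trans (n<1+n (k + k)) 2k+1<L
      ... | inj₁ p∈u | inj₂ q∈w = opposite-walks-endpoints 2k+1<L p∈u q∈w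
      ... | inj₂ p∈w | inj₁ q∈u = λ same → opposite-walks-endpoints 2k+1<L q∈u p∈w (sym same)

      Moore-even≤|edge-ball| : ∀ {c} → suc (k + k) < L → HasCard (InEdgeBall G k u w) c → 2 + sumEven δ k ≤ c
      Moore-even≤|edge-ball| {c} 2k+1<L card = begin
        2 + sumEven δ k                               ≡⟨ sumEven≡2*tree-size δ k ⟩
        tree-size (δ ∸ 1) k + tree-size (δ ∸ 1) k     ≤⟨ +-mono-≤ (tree-size≤|walks| u (w ∷ []) k) (tree-size≤|walks| w (u ∷ []) k) ⟩
        length (walks (u ∷ w ∷ []) k) + length (walks (w ∷ u ∷ []) k)
                                                      ≡⟨ sym (trans (length-map (headOr u) edge-walks) (length-++ (walks (u ∷ w ∷ []) k))) ⟩
        length (map (headOr u) edge-walks)            ≤⟨ length≤HasCard card (Unique-map edge-walks-Unique (edge-walks-endpoint-injective 2k+1<L))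
                                                           in-edge-ball ⟩
        c                                             ∎
        where
        open ≤-Reasoning
        in-edge-ball : ∀ {v} → v ∈ map (headOr u) edge-walks → InEdgeBall G k u w v
        in-edge-ball v∈ with ∈-map⁻ (headOr u) v∈
        ... | p , p∈ , refl with ∈-++⁻ (walks (u ∷ w ∷ []) k) p∈
        ... | inj₁ p∈u = inj₁ (∈-walks⇒InBall u (w ∷ []) k nbu p∈u u)
        ... | inj₂ p∈w = inj₂ (∈-walks⇒InBall w (u ∷ []) k nbw p∈w u)

-- Arcs of a cycle

⊓-≤⇒⊎ : ∀ {x y c} → x ⊓ y ≤ c → x ≤ c ⊎ y ≤ c
⊓-≤⇒⊎ {x} {y} x⊓y≤c with ⊓-sel x y
... | inj₁ x⊓y≡x = inj₁ (subst (_≤ _) x⊓y≡x x⊓y≤c)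
... | inj₂ x⊓y≡y = inj₂ (subst (_≤ _) x⊓y≡y x⊓y≤c)

module CyclicArcs (q′ : ℕ) where

  Q : ℕ
  Q = suc q′

  Arc : ℕ → ℕ → Fin Q → Set
  Arc a w i = ∃[ t ] t ≤ w × toℕ i ≡ (a + t) % Q

  toℕ-mod : ∀ x → toℕ (x mod Q) ≡ x % Q
  toℕ-mod x = toℕ-fromℕ< _

  toℕ%Q : ∀ (i : Fin Q) → toℕ i % Q ≡ toℕ i
  toℕ%Q i = m<n⇒m%n≡m (toℕ<n i)

  ≡-mod : ∀ (i : Fin Q) x → toℕ i ≡ x % Q → i ≡ x mod Q
  ≡-mod i x e = toℕ-injective (trans e (sym (toℕ-mod x)))

  %-absorbˡ : ∀ x y → (x % Q + y) % Q ≡ (x + y) % Q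
  %-absorbˡ x y = begin
    (x % Q + y) % Q          ≡⟨ %-distribˡ-+ (x % Q) y Q ⟩
    (x % Q % Q + y % Q) % Q  ≡⟨ cong (λ z → (z + y % Q) % Q) (m%n%n≡m%n x Q) ⟩
    (x % Q + y % Q) % Q      ≡⟨ sym (%-distribˡ-+ x y Q) ⟩
    (x + y) % Q              ∎
    where open ≡-Reasoning

  %-absorbʳ : ∀ x y → (x + y % Q) % Q ≡ (x + y) % Q
  %-absorbʳ x y = begin
    (x + y % Q) % Q  ≡⟨ cong (_% Q) (+-comm x (y % Q)) ⟩
    (y % Q + x) % Q  ≡⟨ %-absorbˡ y x ⟩
    (y + x) % Q      ≡⟨ cong (_% Q) (+-comm y x) ⟩
    (x + y) % Q      ∎
    where open ≡-Reasoning

  +-inverse-% : ∀ x c → (x + c + (Q ∸ c % Q)) % Q ≡ x % Q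
  +-inverse-% x c = begin
    (x + c + (Q ∸ c % Q)) % Q        ≡⟨ cong (_% Q) (+-assoc x c _) ⟩
    (x + (c + (Q ∸ c % Q))) % Q      ≡⟨ sym (%-absorbʳ x _) ⟩
    (x + (c + (Q ∸ c % Q)) % Q) % Q  ≡⟨ cong (λ z → (x + z) % Q) c+[Q∸c]≡0 ⟩
    (x + 0) % Q                      ≡⟨ cong (_% Q) (+-identityʳ x) ⟩
    x % Q                            ∎
    where
    open ≡-Reasoning
    c+[Q∸c]≡0 : (c + (Q ∸ c % Q)) % Q ≡ 0
    c+[Q∸c]≡0 = trans (sym (%-absorbˡ c _)) (trans (cong (_% Q) (m+[n∸m]≡n (m%n≤n c Q))) (n%n≡0 Q))

  %-cancelʳ-+ : ∀ x y c → (x + c) % Q ≡ (y + c) % Q → x % Q ≡ y % Q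
  %-cancelʳ-+ x y c e = begin
    x % Q                  ≡⟨ sym (+-inverse-% x c) ⟩
    (x + c + r) % Q        ≡⟨ sym (%-absorbˡ (x + c) r) ⟩
    ((x + c) % Q + r) % Q  ≡⟨ cong (λ z → (z + r) % Q) e ⟩
    ((y + c) % Q + r) % Q  ≡⟨ %-absorbˡ (y + c) r ⟩
    (y + c + r) % Q        ≡⟨ +-inverse-% y c ⟩
    y % Q                  ∎
    where
    open ≡-Reasoning
    r = Q ∸ c % Q

  cycDist-offset : ∀ {i s} → i < Q → s < Q → cycDist Q i ((i + s) % Q) ≡ s ⊓ (Q ∸ s)
  cycDist-offset {i} {s} i<Q s<Q with i + s <? Q
  ... | yes i+s<Q rewrite m<n⇒m%n≡m i+s<Q | ∣m-m+n∣≡n i s = refl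
  ... | no  i+s≮Q = begin
      cycDist Q i ((i + s) % Q)          ≡⟨ cong (cycDist Q i) wrap ⟩
      ∣ i - j ∣ ⊓ (Q ∸ ∣ i - j ∣)        ≡⟨ cong (λ d → d ⊓ (Q ∸ d)) ∣i-j∣≡Q∸s ⟩
      (Q ∸ s) ⊓ (Q ∸ (Q ∸ s))            ≡⟨ cong ((Q ∸ s) ⊓_) (m∸[m∸n]≡n (<⇒≤ s<Q)) ⟩
      (Q ∸ s) ⊓ s                        ≡⟨ ⊓-comm (Q ∸ s) s ⟩
      s ⊓ (Q ∸ s)                        ∎
    where
    open ≡-Reasoning
    Q≤i+s : Q ≤ i + s
    Q≤i+s = ≮⇒≥ i+s≮Q
    j = i + s ∸ Q
    wrap : (i + s) % Q ≡ j
    wrap = trans (sym (m≤n⇒[n∸m]%m≡n%m Q≤i+s))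
                 (m<n⇒m%n≡m (+-cancelʳ-< Q j Q (subst (_< Q + Q) (sym (m∸n+n≡m Q≤i+s)) (+-mono-< i<Q s<Q))))
    j+[Q∸s]≡i : j + (Q ∸ s) ≡ i
    j+[Q∸s]≡i = +-cancelʳ-≡ s (j + (Q ∸ s)) i (begin
      j + (Q ∸ s) + s      ≡⟨ +-assoc j (Q ∸ s) s ⟩
      j + (Q ∸ s + s)      ≡⟨ cong (j +_) (m∸n+n≡m (<⇒≤ s<Q)) ⟩
      j + Q                ≡⟨ m∸n+n≡m Q≤i+s ⟩
      i + s                ∎)
    ∣i-j∣≡Q∸s : ∣ i - j ∣ ≡ Q ∸ s
    ∣i-j∣≡Q∸s = trans (∣-∣-comm i j) (trans (cong (∣ j -_∣) (sym j+[Q∸s]≡i)) (∣m-m+n∣≡n j (Q ∸ s)))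

  forward-offset : ∀ (i j : Fin Q) → ∃[ s ] s < Q × (toℕ i + s) % Q ≡ toℕ j
  forward-offset i j = s , m%n<n (toℕ j + (Q ∸ toℕ i)) Q , (begin
    (toℕ i + s) % Q                        ≡⟨ %-absorbʳ (toℕ i) _ ⟩
    (toℕ i + (toℕ j + (Q ∸ toℕ i))) % Q    ≡⟨ cong (_% Q) (solve 3 (λ i j r → i :+ (j :+ r) := j :+ (i :+ r)) refl (toℕ i) (toℕ j) (Q ∸ toℕ i)) ⟩
    (toℕ j + (toℕ i + (Q ∸ toℕ i))) % Q    ≡⟨ cong (λ z → (toℕ j + z) % Q) (m+[n∸m]≡n (<⇒≤ (toℕ<n i))) ⟩
    (toℕ j + Q) % Q                        ≡⟨ [m+n]%n≡m%n (toℕ j) Q ⟩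
    toℕ j % Q                              ≡⟨ toℕ%Q j ⟩
    toℕ j                                  ∎)
    where
    open ≡-Reasoning
    open +-*-Solver
    s = (toℕ j + (Q ∸ toℕ i)) % Q

  -- Position i + (Q ∸ c) is i - c.
  near⇒window : ∀ c (i j : Fin Q) → c ≤ Q → cycDist Q (toℕ i) (toℕ j) ≤ c → Arc (toℕ i + (Q ∸ c)) (c + c) j
  near⇒window c i j c≤Q near with forward-offset i j
  ... | s , s<Q , i+s≡j with ⊓-≤⇒⊎ (subst (_≤ c) (trans (cong (cycDist Q (toℕ i)) (sym i+s≡j)) (cycDist-offset (toℕ<n i) s<Q)) near)
  ... | inj₁ s≤c = s + c , +-monoˡ-≤ c s≤c , sym (begin
    (toℕ i + (Q ∸ c) + (s + c)) % Q     ≡⟨ cong (_% Q) (solve 4 (λ i r s c → i :+ r :+ (s :+ c) := i :+ s :+ (r :+ c)) refl (toℕ i) (Q ∸ c) s c) ⟩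
    (toℕ i + s + (Q ∸ c + c)) % Q       ≡⟨ cong (λ z → (toℕ i + s + z) % Q) (m∸n+n≡m c≤Q) ⟩
    (toℕ i + s + Q) % Q                 ≡⟨ [m+n]%n≡m%n (toℕ i + s) Q ⟩
    (toℕ i + s) % Q                     ≡⟨ i+s≡j ⟩
    toℕ j                               ∎)
    where
    open ≡-Reasoning
    open +-*-Solver
  ... | inj₂ Q∸s≤c = s ∸ (Q ∸ c) , ≤-trans t≤c (m≤m+n c c) , sym (begin-equality
    (toℕ i + (Q ∸ c) + (s ∸ (Q ∸ c))) % Q  ≡⟨ cong (_% Q) (+-assoc (toℕ i) (Q ∸ c) _) ⟩
    (toℕ i + ((Q ∸ c) + (s ∸ (Q ∸ c)))) % Q ≡⟨ cong (λ z → (toℕ i + z) % Q) (m+[n∸m]≡n Q∸c≤s) ⟩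
    (toℕ i + s) % Q                        ≡⟨ i+s≡j ⟩
    toℕ j                                  ∎)
    where
    open ≤-Reasoning
    Q∸c≤s : Q ∸ c ≤ s
    Q∸c≤s = begin
      Q ∸ c                ≤⟨ ∸-monoˡ-≤ c (m≤n+m∸n Q s) ⟩
      s + (Q ∸ s) ∸ c      ≤⟨ ∸-monoˡ-≤ c (+-monoʳ-≤ s Q∸s≤c) ⟩
      s + c ∸ c            ≡⟨ m+n∸n≡m s c ⟩
      s                    ∎
    t≤c : s ∸ (Q ∸ c) ≤ c
    t≤c = ≤-trans (∸-monoˡ-≤ (Q ∸ c) (<⇒≤ s<Q)) (≤-reflexive (m∸[m∸n]≡n c≤Q))

  short-offset : ∀ {s c} → c + c + c < Q → s ≤ c + c → s ⊓ (Q ∸ s) ≤ c → s ≤ c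
  short-offset {s} {c} 3c<Q s≤2c near with ⊓-≤⇒⊎ near
  ... | inj₁ s≤c   = s≤c
  ... | inj₂ Q∸s≤c = ⊥-elim (<-irrefl refl (begin-strict
    Q                ≤⟨ m≤n+m∸n Q s ⟩
    s + (Q ∸ s)      ≤⟨ +-mono-≤ s≤2c Q∸s≤c ⟩
    c + c + c        <⟨ 3c<Q ⟩
    Q                ∎))
    where open ≤-Reasoning

  module _ {c : ℕ} (3c<Q : c + c + c < Q) {J : Fin Q → Set} (J? : ∀ i → Dec (J i))
           (close : ∀ i j → J i → J j → cycDist Q (toℕ i) (toℕ j) ≤ c) where

    private
      c≤Q : c ≤ Q
      c≤Q = ≤-trans (≤-trans (m≤m+n c c) (m≤m+n (c + c) c)) (<⇒≤ 3c<Q)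

    -- A member at offset s ≤ 2c after the first member of the window is at cyclic distance
    -- min(s, Q - s) ≤ c from it, and Q - s ≤ c is impossible as 3c < Q.
    first-in-window : ∀ b → (∀ j → J j → Arc b (c + c) j) → ∀ {t} → J ((b + t) mod Q) →
                      ∃[ a ] ∀ j → J j → Arc a c j
    first-in-window b window J[b+t] with least (λ t → J? ((b + t) mod Q)) J[b+t]
    ... | t* , J[b+t*] , first = b + t* , in-arc
      where
      in-arc : ∀ j → J j → Arc (b + t*) c j
      in-arc j Jj with window j Jj
      ... | o , o≤2c , j≡b+o = s , short-offset 3c<Q s≤2c (subst (_≤ c) cycDist≡ (close _ j J[b+t*] Jj)) , j≡a+s
        where
        t*≤o : t* ≤ o
        t*≤o = first (subst J (≡-mod j (b + o) j≡b+o) Jj)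
        s = o ∸ t*
        s≤2c : s ≤ c + c
        s≤2c = ≤-trans (m∸n≤m o t*) o≤2c
        j≡a+s : toℕ j ≡ (b + t* + s) % Q
        j≡a+s = trans j≡b+o (cong (_% Q) (sym (trans (+-assoc b t* s) (cong (b +_) (m+[n∸m]≡n t*≤o)))))
        cycDist≡ : cycDist Q (toℕ ((b + t*) mod Q)) (toℕ j) ≡ s ⊓ (Q ∸ s)
        cycDist≡ = trans (cong₂ (cycDist Q) (toℕ-mod (b + t*)) (trans j≡a+s (sym (%-absorbˡ (b + t*) s))))
                         (cycDist-offset (m%n<n (b + t*) Q) (≤-<-trans s≤2c (≤-<-trans (m≤m+n (c + c) c) 3c<Q)))

    Arc-around : ∀ i₀ → J i₀ → ∃[ a ] ∀ j → J j → Arc a c j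
    Arc-around i₀ Ji₀ = first-in-window (toℕ i₀ + (Q ∸ c)) (λ j Jj → near⇒window c i₀ j c≤Q (close i₀ j Ji₀ Jj))
                          (subst J (≡-mod i₀ (toℕ i₀ + (Q ∸ c) + c) (sym i₀-c+c≡i₀)) Ji₀)
      where
      i₀-c+c≡i₀ : (toℕ i₀ + (Q ∸ c) + c) % Q ≡ toℕ i₀
      i₀-c+c≡i₀ = begin
        (toℕ i₀ + (Q ∸ c) + c) % Q   ≡⟨ cong (_% Q) (trans (+-assoc (toℕ i₀) (Q ∸ c) c) (cong (toℕ i₀ +_) (m∸n+n≡m c≤Q))) ⟩
        (toℕ i₀ + Q) % Q             ≡⟨ [m+n]%n≡m%n (toℕ i₀) Q ⟩
        toℕ i₀ % Q                   ≡⟨ toℕ%Q i₀ ⟩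
        toℕ i₀                       ∎
        where open ≡-Reasoning

    bounded-diameter⇒Arc : ∃[ a ] ∀ j → J j → Arc a c j
    bounded-diameter⇒Arc with any? J?
    ... | yes (i₀ , Ji₀) = Arc-around i₀ Ji₀
    ... | no  ∄J         = 0 , λ j Jj → ⊥-elim (∄J (j , Jj))

  arc : ℕ → ℕ → List (Fin Q)
  arc a w = map (λ t → (a + t) mod Q) (upTo (suc w))

  length-arc : ∀ a w → length (arc a w) ≡ suc w
  length-arc a w = trans (length-map _ (upTo (suc w))) (length-upTo (suc w))

  Arc⇒∈arc : ∀ a {w i} → Arc a w i → i ∈ arc a w
  Arc⇒∈arc a {w} {i} (t , t≤w , i≡a+t) =
    subst (_∈ arc a w) (sym (≡-mod i (a + t) i≡a+t)) (∈-map⁺ (λ t → (a + t) mod Q) (∈-upTo⁺ (s≤s t≤w)))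

  module _ {J : Fin Q → Set} (J? : ∀ i → Dec (J i)) (a : ℕ) {w} (J⊆Arc : ∀ i → J i → Arc a w i) where

    count≤|Arc| : count J? ≤ suc w
    count≤|Arc| = subst (count J? ≤_) (length-arc a w) (HasCard≤length (count-HasCard J?) λ {i} Ji → Arc⇒∈arc a (J⊆Arc i Ji))

    count≥|Arc|⇒Arc⊆ : suc w ≤ count J? → ∀ i → Arc a w i → J i
    count≥|Arc|⇒Arc⊆ w<count i i∈Arc =
      HasCard-tight (count-HasCard J?) J? (λ {i} Ji → Arc⇒∈arc a (J⊆Arc i Ji))
        (subst (_≤ count J?) (sym (length-arc a w)) w<count) (Arc⇒∈arc a i∈Arc)

  Arc⇔InArc : ∀ a A B i → Arc a (A + B) i ⇔ InArc Q A B ((a + A) mod Q) i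
  Arc⇔InArc a A B i = mk⇔ to from
    where
    open ≡-Reasoning
    shift : ∀ t → ((a + A) % Q + t) % Q ≡ (a + t + A) % Q
    shift t = begin
      ((a + A) % Q + t) % Q  ≡⟨ %-absorbˡ (a + A) t ⟩
      (a + A + t) % Q        ≡⟨ cong (_% Q) (trans (+-assoc a A t) (trans (cong (a +_) (+-comm A t)) (sym (+-assoc a t A)))) ⟩
      (a + t + A) % Q        ∎
    to : Arc a (A + B) i → InArc Q A B ((a + A) mod Q) i
    to (t , t≤ , i≡a+t) = t , t≤ , (begin
      (toℕ i + A) % Q                  ≡⟨ cong (λ z → (z + A) % Q) i≡a+t ⟩
      ((a + t) % Q + A) % Q            ≡⟨ %-absorbˡ (a + t) A ⟩
      (a + t + A) % Q                  ≡⟨ sym (shift t) ⟩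
      ((a + A) % Q + t) % Q            ≡⟨ cong (λ z → (z + t) % Q) (sym (toℕ-mod (a + A))) ⟩
      (toℕ ((a + A) mod Q) + t) % Q    ∎)
    from : InArc Q A B ((a + A) mod Q) i → Arc a (A + B) i
    from (t , t≤ , e) = t , t≤ , trans (sym (toℕ%Q i)) (%-cancelʳ-+ (toℕ i) (a + t) A (begin
      (toℕ i + A) % Q                  ≡⟨ e ⟩
      (toℕ ((a + A) mod Q) + t) % Q    ≡⟨ cong (λ z → (z + t) % Q) (toℕ-mod (a + A)) ⟩
      ((a + A) % Q + t) % Q            ≡⟨ shift t ⟩
      (a + t + A) % Q                  ∎))

  -- Position a + q′ is a - 1.
  Arc-extendˡ : ∀ a {w i} → Arc a w i → Arc (a + q′) (suc w) i
  Arc-extendˡ a (t , t≤w , i≡a+t) = suc t , s≤s t≤w , trans i≡a+t (sym (begin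
    (a + q′ + suc t) % Q  ≡⟨ cong (_% Q) (solve 3 (λ a q t → a :+ q :+ (con 1 :+ t) := a :+ t :+ (con 1 :+ q)) refl a q′ t) ⟩
    (a + t + Q) % Q       ≡⟨ [m+n]%n≡m%n (a + t) Q ⟩
    (a + t) % Q           ∎))
    where
    open ≡-Reasoning
    open +-*-Solver

  Arc-next⁻ : ∀ a {w i} → Arc a w (next i) → Arc (a + q′) (suc w) i
  Arc-next⁻ a {i = i} (t , t≤w , next≡a+t) =
    t , m≤n⇒m≤1+n t≤w , trans (sym (toℕ%Q i)) (%-cancelʳ-+ (toℕ i) (a + q′ + t) 1 (begin
      (toℕ i + 1) % Q       ≡⟨ cong (_% Q) (+-comm (toℕ i) 1) ⟩
      suc (toℕ i) % Q       ≡⟨ sym (toℕ-mod (suc (toℕ i))) ⟩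
      toℕ (next i)          ≡⟨ next≡a+t ⟩
      (a + t) % Q           ≡⟨ sym ([m+n]%n≡m%n (a + t) Q) ⟩
      (a + t + Q) % Q       ≡⟨ cong (_% Q) (solve 3 (λ a q t → a :+ t :+ (con 1 :+ q) := a :+ q :+ t :+ con 1) refl a q′ t) ⟩
      (a + q′ + t + 1) % Q  ∎))
    where
    open ≡-Reasoning
    open +-*-Solver

-- Equatorial graphs

double : ∀ h → h * 2 ≡ h + h
double h = trans (*-suc h 1) (cong (h +_) (*-identityʳ h))

⌊1+n+n/2⌋≡n : ∀ n → ⌊ suc (n + n) /2⌋ ≡ n
⌊1+n+n/2⌋≡n zero    = refl
⌊1+n+n/2⌋≡n (suc n) = cong suc (trans (cong ⌊_/2⌋ (+-suc n n)) (⌊1+n+n/2⌋≡n n))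

≡1+2h⇒≡1+2k : ∀ {g : ℕ} h → g ≡ suc (h + h) → g ≡ suc (kOf g + kOf g)
≡1+2h⇒≡1+2k h refl = cong (λ k → suc (k + k)) (n≡⌊n+n/2⌋ h)

≡2h⇒≡2+2k : ∀ {g : ℕ} h → g ≡ h + h → 0 < g → g ≡ suc (suc (kOf g + kOf g))
≡2h⇒≡2+2k zero    refl ()
≡2h⇒≡2+2k (suc h) refl _ = trans (cong suc (+-suc h h)) (cong (λ k → suc (suc (k + k))) (sym kOf≡h))
  where
  kOf≡h : kOf (suc h + suc h) ≡ h
  kOf≡h = trans (cong ⌊_/2⌋ (+-suc h h)) (⌊1+n+n/2⌋≡n h)

odd⇒≡1+2k : ∀ g → g % 2 ≡ 1 → g ≡ suc (kOf g + kOf g)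
odd⇒≡1+2k g odd = ≡1+2h⇒≡1+2k (g / 2) (trans (m≡m%n+[m/n]*n g 2) (cong₂ _+_ odd (double (g / 2))))

even⇒≡2+2k : ∀ g → g % 2 ≡ 0 → 0 < g → g ≡ suc (suc (kOf g + kOf g))
even⇒≡2+2k g even = ≡2h⇒≡2+2k (g / 2) (trans (m≡m%n+[m/n]*n g 2) (cong₂ _+_ even (double (g / 2))))

Moore-odd : ∀ δ g → g % 2 ≡ 1 → Moore δ g ≡ 1 + sumOdd δ (kOf g)
Moore-odd δ g odd rewrite odd = refl

Moore-even : ∀ δ g → g % 2 ≡ 0 → Moore δ g ≡ 2 + sumEven δ (kOf g)
Moore-even δ g even rewrite even = refl

module _ (G : Graph) {q′ : ℕ} (u : Fin (suc q′) → Fin (n G))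
         (isometric : ∀ i j → Dist G (u i) (u j) (cycDist (suc q′) (toℕ i) (toℕ j))) where

  open CyclicArcs q′

  ball-indices-close : ∀ k v i j → InBall G k (u i) v → InBall G k (u j) v → cycDist Q (toℕ i) (toℕ j) ≤ k + k
  ball-indices-close k v i j v∈Bi v∈Bj with InBall-common G v∈Bi v∈Bj
  ... | l , l≤2k , walk = ≤-trans (proj₂ (isometric i j) l walk) l≤2k

  ball-indices-Arc : ∀ k → (k + k) + (k + k) + (k + k) < Q → ∀ v →
                     ∃[ a ] ∀ i → InBall G k (u i) v → Arc a (k + k) i
  ball-indices-Arc k 6k<Q v = bounded-diameter⇒Arc 6k<Q (λ i → InBall? G k (u i) v) (ball-indices-close k v)

  edge-ball-indices-Arc : ∀ k → (k + k) + (k + k) + (k + k) < Q → ∀ v →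
                          ∃[ a ] ∀ i → InEdgeBall G k (u i) (u (next i)) v → Arc a (suc (k + k)) i
  edge-ball-indices-Arc k 6k<Q v with ball-indices-Arc k 6k<Q v
  ... | a , J⊆Arc = a + q′ , λ where
    i (inj₁ v∈Bi)    → Arc-extendˡ a (J⊆Arc i v∈Bi)
    i (inj₂ v∈Bnext) → Arc-next⁻ a (J⊆Arc (next i) v∈Bnext)

  double-counting-arcs : ∀ {R : Fin Q → Fin (n G) → Set} (R? : ∀ i v → Dec (R i v)) {M g A B} →
          g ≡ suc (A + B) → n G * g ≡ Q * M → (∀ i → ∀ {c} → HasCard (R i) c → M ≤ c) →
          (∀ v → ∃[ a ] ∀ i → R i v → Arc a (A + B) i) →
          (∀ i → HasCard (R i) M)
          × (∀ v → HasCard (λ i → R i v) g × Σ (Fin Q) λ j → ∀ i → R i v ⇔ InArc Q A B j i)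
  double-counting-arcs {R} R? {M} {g} {A} {B} refl nM≡QM M≤ arcs = row , column
    where
    counts : (∀ i → count (R? i) ≡ M) × (∀ v → count (λ i → R? i v) ≡ g)
    counts = double-counting-rigid R? nM≡QM (λ i → M≤ i (count-HasCard (R? i)))
               (λ v → count≤|Arc| (λ i → R? i v) (proj₁ (arcs v)) (proj₂ (arcs v)))
    row : ∀ i → HasCard (R i) M
    row i = subst (HasCard (R i)) (proj₁ counts i) (count-HasCard (R? i))
    column : ∀ v → HasCard (λ i → R i v) g × Σ (Fin Q) λ j → ∀ i → R i v ⇔ InArc Q A B j i
    column v with arcs v
    ... | a , R⊆Arc =
        subst (HasCard (λ i → R i v)) (proj₂ counts v) (count-HasCard (λ i → R? i v))
      , (a + A) mod Q
      , λ i → ⇔-trans (mk⇔ (R⊆Arc i) (count≥|Arc|⇒Arc⊆ (λ i → R? i v) a R⊆Arc (≤-reflexive (sym (proj₂ counts v))) i))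
                      (Arc⇔InArc a A B i)

6k+3<q⇒2k+2k+2k<q : ∀ k {q} → 6 * k + 3 < q → (k + k) + (k + k) + (k + k) < q
6k+3<q⇒2k+2k+2k<q k 6k+3<q = ≤-<-trans (≤-trans (≤-reflexive (solve 1 (λ k → (k :+ k) :+ (k :+ k) :+ (k :+ k) := con 6 :* k) refl k))
                                       (m≤m+n (6 * k) 3)) 6k+3<q
  where open +-*-Solver

lemma14 : (G : Graph) (g δ q : ℕ) → IsEquatorial G g δ q →
    (u : Fin q → Fin (n G)) → IsIsometricCycle G q u →
    ((g % 2 ≡ 1) →
      (∀ i → HasCard (InBall G (kOf g) (u i)) (Moore δ g))
      × (∀ v → HasCard (λ i → InBall G (kOf g) (u i) v) g
               × Σ (Fin q) λ j → ∀ i → InBall G (kOf g) (u i) v ⇔ InArc q (kOf g) (kOf g) j i))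
    × ((g % 2 ≡ 0) →
      (∀ i → HasCard (InEdgeBall G (kOf g) (u i) (u (next i))) (Moore δ g))
      × (∀ v → HasCard (λ i → InEdgeBall G (kOf g) (u i) (u (next i)) v) g
               × Σ (Fin q) λ j → ∀ i → InEdgeBall G (kOf g) (u i) (u (next i)) v ⇔ InArc q (suc (kOf g)) (kOf g) j i))
lemma14 G g δ zero (_ , _ , _ , _ , _ , () , _) u _
lemma14 G g δ (suc q′) ((_ , long) , (degree , _) , _ , _ , 3≤g , 6k+3<q , nM≡qM) u ((_ , _ , u~next) , isometric) =
    (λ g-odd → let g≡1+2k = odd⇒≡1+2k g g-odd in
      double-counting-arcs G u isometric (λ i v → InBall? G k (u i) v) g≡1+2k nM≡qM
        (λ i card → subst (_≤ _) (sym (Moore-odd δ g g-odd))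
                      (Moore-odd≤|ball| long k (u i) (≤-reflexive (sym g≡1+2k)) card))
        (ball-indices-Arc G u isometric k 2k+2k+2k<q))
  , (λ g-even → let g≡2+2k = even⇒≡2+2k g g-even (≤-trans (s≤s z≤n) 3≤g) in
      double-counting-arcs G u isometric (λ i v → InBall? G k (u i) v ⊎-dec InBall? G k (u (next i)) v) g≡2+2k nM≡qM
        (λ i card → subst (_≤ _) (sym (Moore-even δ g g-even))
                      (Moore-even≤|edge-ball| long k (u~next i) (≤-reflexive (sym g≡2+2k)) card))
        (edge-ball-indices-Arc G u isometric k 2k+2k+2k<q))
  where
  open MooreBound G degree
  k : ℕ
  k = kOf g
  2k+2k+2k<q : (k + k) + (k + k) + (k + k) < suc q′
  2k+2k+2k<q = 6k+3<q⇒2k+2k+2k<q k 6k+3<q
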